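{- Let $H$ be a finite abelian group, $k\ge3$, $\psi\subseteq H^k$ a subgroup, and $C$ an Additive-CSP$(\psi)$ constraint $\psi(x_1+a_1,\dots,x_k+a_k)=1$ on distinct variables $x_1,\dots,x_k$ with $a_i\in H$. Let $G$ be the label-extended graph of $C$ and $\overline G$ the label-extended graph of the homogeneous constraint $\overline C:\ \psi(x_1,\dots,x_k)=1$. Then: (Completeness) for each assignment $\alpha:\{x_1,\dots,x_k\}\to H$ satisfying $C$, there is an $\alpha$-permutation $f$ which is an edge-preserving bijection (homomorphism) from $G$ to $\overline G$; (Soundness) if $f$ is an $\alpha$-permutation which is a homomorphism from $G$ to $\overline G$, then $\alpha$ satisfies $C$.
   Context: An assignment $\alpha$ satisfies $C$ if $(\alpha(x_1)+a_1,\dots,\alpha(x_k)+a_k)\in\psi$. The label-extended graph of $C$ has, for each $i\in[k]$ and $b\in H$, a variable vertex "$x_i\mapsto b$", and for each assignment $\beta$ satisfying $C$ a constraint vertex "$x_1\mapsto\beta(x_1),\dots,x_k\mapsto\beta(x_k)$"; each constraint vertex $\beta$ is adjacent to the $k$ variable vertices $x_i\mapsto\beta(x_i)$, and there are no other edges. For an assignment $\alpha$, a bijection $f$ from the vertices of $G$ to those of $\overline G$ is an $\alpha$-permutation if $f(x_i\mapsto b)=x_i\mapsto(b-\alpha(x_i))$ for all $i\in[k]$, $b\in H$. A homomorphism from $G$ to $\overline G$ here is a bijection mapping every edge of $G$ to an edge of $\overline G$. -}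

module Defs where

open import Level using (Level; _⊔_)
open import Algebra.Bundles using (AbelianGroup)
open import Data.Nat using (ℕ)
open import Data.Fin using (Fin)
open import Data.Vec using (Vec; lookup; zipWith; replicate)
open import Data.Bool using (Bool; true)
open import Data.Product using (Σ; _×_; _,_)
open import Data.Sum using (_⊎_; inj₁; inj₂)
open import Data.Empty.Polymorphic renaming (⊥ to Lift⊥)
open import Relation.Binary.PropositionalEquality using (_≡_)
open import Function.Bundles using (_↔_; _⤖_; Bijection)

module _ {c ℓ : Level} (H : AbelianGroup c ℓ) where
  open AbelianGroup H renaming (_∙_ to _+_; ε to 0#; _⁻¹ to -_)

  IsStrictEq : Set (c ⊔ ℓ)
  IsStrictEq = ∀ {x y : Carrier} → x ≈ y → x ≡ y

  Finite : Set c
  Finite = Σ ℕ λ n → Carrier ↔ Fin n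

  _⊕_ : {k : ℕ} → Vec Carrier k → Vec Carrier k → Vec Carrier k
  _⊕_ = zipWith _+_

  IsSubgroup : {k : ℕ} → (Vec Carrier k → Bool) → Set c
  IsSubgroup {k} ψ =
      (ψ (replicate k 0#) ≡ true)
    × (∀ u v → ψ u ≡ true → ψ v ≡ true → ψ (u ⊕ v) ≡ true)
    × (∀ u → ψ u ≡ true → ψ (Data.Vec.map -_ u) ≡ true)

  -- α satisfies the constraint ψ(x₁+a₁,…,x_k+a_k)=1 (variables x_i indexed by Fin k)
  Satisfies : {k : ℕ} → (Vec Carrier k → Bool) → Vec Carrier k → Vec Carrier k → Set
  Satisfies ψ a α = ψ (α ⊕ a) ≡ true

  -- vertices of the label-extended graph of the constraint (ψ, a):
  -- variable vertices  x_i ↦ b  and constraint vertices  β  (β satisfying the constraint)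
  Vertex : {k : ℕ} → (Vec Carrier k → Bool) → Vec Carrier k → Set c
  Vertex {k} ψ a = (Fin k × Carrier) ⊎ Σ (Vec Carrier k) (Satisfies ψ a)

  Edge : {k : ℕ} (ψ : Vec Carrier k → Bool) (a : Vec Carrier k) →
         Vertex ψ a → Vertex ψ a → Set c
  Edge ψ a (inj₁ (i , b)) (inj₂ (β , _)) = lookup β i ≡ b
  Edge ψ a (inj₂ (β , _)) (inj₁ (i , b)) = lookup β i ≡ b
  Edge ψ a (inj₁ _) (inj₁ _) = Lift⊥
  Edge ψ a (inj₂ _) (inj₂ _) = Lift⊥

  IsαPermutation : {k : ℕ} (ψ : Vec Carrier k → Bool) (a α : Vec Carrier k) →
                   (Vertex ψ a → Vertex ψ (replicate k 0#)) → Set c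
  IsαPermutation ψ a α f =
    ∀ i b → f (inj₁ (i , b)) ≡ inj₁ (i , b + (- lookup α i))

  IsHomomorphism : {k : ℕ} (ψ : Vec Carrier k → Bool) (a : Vec Carrier k) →
                   (Vertex ψ a → Vertex ψ (replicate k 0#)) → Set c
  IsHomomorphism {k} ψ a f =
    ∀ u v → Edge ψ a u v → Edge ψ (replicate k 0#) (f u) (f v)

-- Translating by a satisfying assignment α is a bijection between the solutions of
-- ψ(x + a) = 1 and those of ψ(x) = 1, because ψ is a subgroup containing α + a; on
-- labels it is exactly the α-permutation b ↦ b − α(xᵢ), and it preserves incidence.
-- Conversely, the all-zero constraint vertex of Ḡ has a preimage under any α-permutation
-- f, necessarily a constraint vertex β of G; each edge β — (xᵢ ↦ β(xᵢ)) is sent to the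
-- edge 0 — (xᵢ ↦ β(xᵢ) − α(xᵢ)), so β = α and α satisfies C.
module Submission where

open import Defs hiding (_⊕_)
open import Level using (Level)
open import Algebra.Bundles using (AbelianGroup)
open import Data.Nat using (ℕ; _≥_)
open import Data.Vec using (Vec; []; _∷_; lookup; map; replicate)
open import Data.Vec.Properties using (lookup-zipWith; lookup-map; lookup-replicate)
open import Data.Vec.Relation.Binary.Pointwise.Inductive
  using (Pointwise-≡⇒≡; zipWith-assoc; zipWith-identityʳ)
open import Data.Vec.Relation.Binary.Pointwise.Extensional using (ext; extensional⇒inductive)
open import Data.Bool using (Bool; true)
open import Data.Bool.Properties using () renaming (_≟_ to _≟ᵇ_)
open import Data.Product using (Σ; _×_; _,_; proj₁; uncurry)
open import Data.Sum using (inj₁; inj₂)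
open import Function.Bundles using (_⤖_; Bijection; mk↔ₛ′)
open import Function.Properties.Inverse using (↔⇒⤖)
open import Relation.Binary.PropositionalEquality
  using (_≡_; refl; sym; trans; cong; cong₂; subst; subst₂; module ≡-Reasoning)
open import Axiom.UniquenessOfIdentityProofs using (module Decidable⇒UIP)
import Algebra.Properties.AbelianGroup as AbelianGroupProperties
import Algebra.Properties.CommutativeSemigroup as CommutativeSemigroupProperties

module LabelExtendedGraph {c ℓ : Level} (H : AbelianGroup c ℓ) (≈⇒≡ : IsStrictEq H) where

  open AbelianGroup H
    using (Carrier; setoid; assoc; identityʳ; inverseʳ; ∙-congˡ; reflexive; commutativeSemigroup)
    renaming (_∙_ to _+_; ε to 0#; _⁻¹ to -_)
  open AbelianGroupProperties H using (⁻¹-∙-comm; //-rightDividesˡ; //-rightDividesʳ; x∙y⁻¹≈ε⇒x≈y)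
  open CommutativeSemigroupProperties commutativeSemigroup using (interchange)

  infixl 6 _⊕_ _⊖_
  _⊕_ _⊖_ : ∀ {k} → Vec Carrier k → Vec Carrier k → Vec Carrier k
  _⊕_ = Defs._⊕_ H
  u ⊖ v = u ⊕ map -_ v

  infixl 6 _-_
  _-_ : Carrier → Carrier → Carrier
  x - y = x + - y

  -+-cancelʳ : ∀ x y → (x - y) + y ≡ x
  -+-cancelʳ x y = ≈⇒≡ (//-rightDividesˡ y x)

  +--cancelʳ : ∀ x y → (x + y) - y ≡ x
  +--cancelʳ x y = ≈⇒≡ (//-rightDividesʳ y x)

  difference-+ʳ-invariant : ∀ x y z → (x + z) - (y + z) ≡ x - y
  difference-+ʳ-invariant x y z = ≈⇒≡ (begin
      (x + z) - (y + z)      ≈⟨ ∙-congˡ (⁻¹-∙-comm y z) ⟨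
      (x + z) + (- y + - z)  ≈⟨ interchange x z (- y) (- z) ⟩
      (x - y) + (z - z)      ≈⟨ ∙-congˡ (inverseʳ z) ⟩
      (x - y) + 0#           ≈⟨ identityʳ (x - y) ⟩
      x - y                  ∎)
    where open import Relation.Binary.Reasoning.Setoid setoid

  -≡0⇒≡ : ∀ {x y} → x - y ≡ 0# → x ≡ y
  -≡0⇒≡ {x} {y} x-y≡0 = ≈⇒≡ (x∙y⁻¹≈ε⇒x≈y x y (reflexive x-y≡0))

  0ᵛ : ∀ {k} → Vec Carrier k
  0ᵛ = replicate _ 0#

  ≡-from-lookup : ∀ {k} {u v : Vec Carrier k} → (∀ i → lookup u i ≡ lookup v i) → u ≡ v
  ≡-from-lookup u≗v = Pointwise-≡⇒≡ (extensional⇒inductive (ext u≗v))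

  lookup-⊖ : ∀ {k} (u v : Vec Carrier k) i → lookup (u ⊖ v) i ≡ lookup u i - lookup v i
  lookup-⊖ u v i = begin
    lookup (u ⊖ v) i                  ≡⟨ lookup-zipWith _+_ i u (map -_ v) ⟩
    lookup u i + lookup (map -_ v) i  ≡⟨ cong (lookup u i +_) (lookup-map i -_ v) ⟩
    lookup u i - lookup v i           ∎
    where open ≡-Reasoning

  ⊕-identityʳ : ∀ {k} (u : Vec Carrier k) → u ⊕ 0ᵛ ≡ u
  ⊕-identityʳ u = Pointwise-≡⇒≡ (zipWith-identityʳ (λ x → ≈⇒≡ (identityʳ x)) u)

  ⊕-assoc : ∀ {k} (u v w : Vec Carrier k) → (u ⊕ v) ⊕ w ≡ u ⊕ (v ⊕ w)
  ⊕-assoc u v w = Pointwise-≡⇒≡ (zipWith-assoc (λ x y z → ≈⇒≡ (assoc x y z)) u v w)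

  ⊖-⊕-cancelʳ : ∀ {k} (u v : Vec Carrier k) → (u ⊖ v) ⊕ v ≡ u
  ⊖-⊕-cancelʳ []      []      = refl
  ⊖-⊕-cancelʳ (x ∷ u) (y ∷ v) = cong₂ _∷_ (-+-cancelʳ x y) (⊖-⊕-cancelʳ u v)

  ⊕-⊖-cancelʳ : ∀ {k} (u v : Vec Carrier k) → (u ⊕ v) ⊖ v ≡ u
  ⊕-⊖-cancelʳ []      []      = refl
  ⊕-⊖-cancelʳ (x ∷ u) (y ∷ v) = cong₂ _∷_ (+--cancelʳ x y) (⊕-⊖-cancelʳ u v)

  ⊖-⊕ʳ-invariant : ∀ {k} (u v w : Vec Carrier k) → (u ⊕ w) ⊖ (v ⊕ w) ≡ u ⊖ v
  ⊖-⊕ʳ-invariant []      []      []      = refl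
  ⊖-⊕ʳ-invariant (x ∷ u) (y ∷ v) (z ∷ w) =
    cong₂ _∷_ (difference-+ʳ-invariant x y z) (⊖-⊕ʳ-invariant u v w)

  module _ {k : ℕ} {ψ : Vec Carrier k → Bool} where

    satisfies-⊖ : IsSubgroup H ψ → ∀ {a α β} → Satisfies H ψ a α → Satisfies H ψ a β →
                  Satisfies H ψ 0ᵛ (β ⊖ α)
    satisfies-⊖ (_ , ψ-⊕ , ψ-neg) {a} {α} {β} α⊨ β⊨ = begin
      ψ ((β ⊖ α) ⊕ 0ᵛ)         ≡⟨ cong ψ (⊕-identityʳ (β ⊖ α)) ⟩
      ψ (β ⊖ α)                ≡⟨ cong ψ (⊖-⊕ʳ-invariant β α a) ⟨
      ψ ((β ⊕ a) ⊖ (α ⊕ a))    ≡⟨ ψ-⊕ _ _ β⊨ (ψ-neg _ α⊨) ⟩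
      true                     ∎
      where open ≡-Reasoning

    satisfies-⊕ : IsSubgroup H ψ → ∀ {a α γ} → Satisfies H ψ a α → Satisfies H ψ 0ᵛ γ →
                  Satisfies H ψ a (γ ⊕ α)
    satisfies-⊕ (_ , ψ-⊕ , _) {a} {α} {γ} α⊨ γ⊨ = begin
      ψ ((γ ⊕ α) ⊕ a)          ≡⟨ cong ψ (⊕-assoc γ α a) ⟩
      ψ (γ ⊕ (α ⊕ a))          ≡⟨ cong (λ u → ψ (u ⊕ (α ⊕ a))) (⊕-identityʳ γ) ⟨
      ψ ((γ ⊕ 0ᵛ) ⊕ (α ⊕ a))   ≡⟨ ψ-⊕ _ _ γ⊨ α⊨ ⟩
      true                     ∎
      where open ≡-Reasoning

    constraint-≡ : ∀ {a β β'} {β⊨ : Satisfies H ψ a β} {β'⊨ : Satisfies H ψ a β'} →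
                   β ≡ β' → _≡_ {A = Vertex H ψ a} (inj₂ (β , β⊨)) (inj₂ (β' , β'⊨))
    constraint-≡ {β⊨ = β⊨} {β'⊨} refl =
      cong (λ p → inj₂ (_ , p)) (Decidable⇒UIP.≡-irrelevant _≟ᵇ_ β⊨ β'⊨)

    0ᵛ-satisfies-homogeneous : ψ 0ᵛ ≡ true → Satisfies H ψ 0ᵛ 0ᵛ
    0ᵛ-satisfies-homogeneous ψ0 = trans (cong ψ (⊕-identityʳ 0ᵛ)) ψ0

    module Translation (ψ-subgroup : IsSubgroup H ψ) {a α : Vec Carrier k}
                       (α⊨ : Satisfies H ψ a α) where

      translate : Vertex H ψ a → Vertex H ψ 0ᵛ
      translate (inj₁ (i , b))  = inj₁ (i , b - lookup α i)
      translate (inj₂ (β , β⊨)) = inj₂ (β ⊖ α , satisfies-⊖ ψ-subgroup α⊨ β⊨)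

      untranslate : Vertex H ψ 0ᵛ → Vertex H ψ a
      untranslate (inj₁ (i , b))  = inj₁ (i , b + lookup α i)
      untranslate (inj₂ (γ , γ⊨)) = inj₂ (γ ⊕ α , satisfies-⊕ ψ-subgroup α⊨ γ⊨)

      translate∘untranslate : ∀ v → translate (untranslate v) ≡ v
      translate∘untranslate (inj₁ (i , b)) = cong (λ b′ → inj₁ (i , b′)) (+--cancelʳ b _)
      translate∘untranslate (inj₂ (γ , _)) = constraint-≡ (⊕-⊖-cancelʳ γ α)

      untranslate∘translate : ∀ v → untranslate (translate v) ≡ v
      untranslate∘translate (inj₁ (i , b)) = cong (λ b′ → inj₁ (i , b′)) (-+-cancelʳ b _)
      untranslate∘translate (inj₂ (β , _)) = constraint-≡ (⊖-⊕-cancelʳ β α)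

      translation : Vertex H ψ a ⤖ Vertex H ψ 0ᵛ
      translation = ↔⇒⤖ (mk↔ₛ′ translate untranslate translate∘untranslate untranslate∘translate)

      translate-αPermutation : IsαPermutation H ψ a α translate
      translate-αPermutation i b = refl

      translate-homomorphism : IsHomomorphism H ψ a translate
      translate-homomorphism (inj₁ (i , b)) (inj₂ (β , _)) βᵢ≡b =
        trans (lookup-⊖ β α i) (cong (_- lookup α i) βᵢ≡b)
      translate-homomorphism (inj₂ (β , _)) (inj₁ (i , b)) βᵢ≡b =
        trans (lookup-⊖ β α i) (cong (_- lookup α i) βᵢ≡b)

    module _ {a α : Vec Carrier k} {f : Vertex H ψ a → Vertex H ψ 0ᵛ}
             (f-perm : IsαPermutation H ψ a α f) (f-hom : IsHomomorphism H ψ a f) where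

      αPermutation-homomorphism-translates :
        ∀ {β β⊨ γ γ⊨} → f (inj₂ (β , β⊨)) ≡ inj₂ (γ , γ⊨) →
        ∀ i → lookup γ i ≡ lookup β i - lookup α i
      αPermutation-homomorphism-translates {β} {β⊨} fβ≡γ i =
        subst₂ (Edge H ψ 0ᵛ) (f-perm i (lookup β i)) fβ≡γ
               (f-hom (inj₁ (i , lookup β i)) (inj₂ (β , β⊨)) refl)

      preimage-of-0ᵛ-satisfies : ∀ {γ⊨} v → f v ≡ inj₂ (0ᵛ , γ⊨) → Satisfies H ψ a α
      preimage-of-0ᵛ-satisfies (inj₁ (i , b)) fv≡0ᵛ with () ← trans (sym (f-perm i b)) fv≡0ᵛ
      preimage-of-0ᵛ-satisfies (inj₂ (β , β⊨)) fβ≡0ᵛ = subst (Satisfies H ψ a) β≡α β⊨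
        where
        β≡α : β ≡ α
        β≡α = ≡-from-lookup λ i →
          -≡0⇒≡ (trans (sym (αPermutation-homomorphism-translates fβ≡0ᵛ i))
                       (lookup-replicate i 0#))

    αPermutation-homomorphism⇒satisfies :
      ψ 0ᵛ ≡ true → ∀ {a α} (f : Vertex H ψ a ⤖ Vertex H ψ 0ᵛ) →
      IsαPermutation H ψ a α (Bijection.to f) → IsHomomorphism H ψ a (Bijection.to f) →
      Satisfies H ψ a α
    αPermutation-homomorphism⇒satisfies ψ0 f f-perm f-hom =
      uncurry (preimage-of-0ᵛ-satisfies f-perm f-hom)
              (Bijection.strictlySurjective f (inj₂ (0ᵛ , 0ᵛ-satisfies-homogeneous ψ0)))

lemma7p5 : {c ℓ : Level} (H : AbelianGroup c ℓ) → IsStrictEq H → Finite H →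
    (k : ℕ) → k ≥ 3 →
    (ψ : Vec (AbelianGroup.Carrier H) k → Bool) → IsSubgroup H ψ →
    (a : Vec (AbelianGroup.Carrier H) k) →
    ((α : Vec (AbelianGroup.Carrier H) k) → Satisfies H ψ a α →
      Σ (Vertex H ψ a ⤖ Vertex H ψ (replicate k (AbelianGroup.ε H))) λ f →
        IsαPermutation H ψ a α (Bijection.to f) × IsHomomorphism H ψ a (Bijection.to f))
    × ((α : Vec (AbelianGroup.Carrier H) k) →
       (f : Vertex H ψ a ⤖ Vertex H ψ (replicate k (AbelianGroup.ε H))) →
       IsαPermutation H ψ a α (Bijection.to f) → IsHomomorphism H ψ a (Bijection.to f) →
       Satisfies H ψ a α)
lemma7p5 H ≈⇒≡ _ _ _ _ ψ-subgroup _ =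
    (λ α α⊨ → let open Translation ψ-subgroup α⊨
              in translation , translate-αPermutation , translate-homomorphism)
  , (λ _ → αPermutation-homomorphism⇒satisfies (proj₁ ψ-subgroup))
  where open LabelExtendedGraph H ≈⇒≡
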